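{- Let $V_1,\dots,V_r$ be finite-dimensional vector spaces over a field. A sequence of vertices $(x_{W_0},\dots,x_{W_l})$ of $\mathcal{B}(V_1,\dots,V_r)$ is a geodesic cycle if and only if one of the following holds: (1) all $W_s$ lie in a single $V_i$ and $(x_{W_0},\dots,x_{W_l})$ is a geodesic cycle in $\mathcal{B}(V_i)$; (2) there exist $i\ne j$ such that $W_0\subseteq V_i$, the $W_s$ lie alternately in $V_i$ and $V_j$, $l$ is even, $(x_{W_0},x_{W_2},\dots,x_{W_l})$ is a closed walk in $X_0(V_i)$, and $(x_{W_1},x_{W_3},\dots,x_{W_{l-1}},x_{W_1})$ is a closed walk in $X_0(V_j)$.
   Context: $\mathcal{B}(V)$ has vertices $x_W$ for nonzero proper subspaces $W\subseteq V$ and simplices the flags; $x_W,x_{W'}$ are opposite iff $V=W\oplus W'$. $\mathcal{B}(V_1,\dots,V_r)$ is the join of the $\mathcal{B}(V_i)$ (disjoint union of vertices, simplices unions of one simplex from each factor); two vertices of the join are opposite iff they lie in the same factor and are opposite there. Links of vertices are joins with the induced opposition (the link of $x_W$, $W\subseteq V_i$, is the join of the $\mathcal{B}(V_j)$, $j\ne i$, with $\mathcal{B}(W)$ and $\mathcal{B}(V_i/W)$). A path has consecutive vertices distinct and forming a simplex; it is geodesic if $x_{s-1},x_{s+1}$ are opposite in the link of $x_s$ for all interior $s$. A geodesic cycle is $(x_0,\dots,x_l)$ with $x_l=x_0$ and $(x_0,\dots,x_l,x_1)$ a geodesic path. $X_0(V)$ is the undirected graph on nonzero proper subspaces of $V$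 with $x_{W}\sim x_{W'}$ iff $W\oplus W'=V$; a closed walk is a sequence of vertices with consecutive ones adjacent and last equal to first. -}

module Defs where

open import Level using (Level; _⊔_)
open import Algebra.Bundles using (CommutativeRing)
open import Data.Nat using (ℕ; zero; suc; _≤_; _<_)
import Data.Nat
open import Data.Fin using (Fin)
open import Data.Product using (Σ; _×_; _,_; ∃; ∃-syntax; proj₁; proj₂)
open import Relation.Nullary using (¬_)
open import Relation.Binary.PropositionalEquality using (_≡_; _≢_)

record Field (c ℓ : Level) : Set (Level.suc (c ⊔ ℓ)) where
  field
    commRing : CommutativeRing c ℓ
  open CommutativeRing commRing public
  field
    0≉1     : ¬ (0# ≈ 1#)
    inverse : ∀ x → ¬ (x ≈ 0#) → Σ Carrier λ y → (x * y) ≈ 1#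

IsEven : ℕ → Set
IsEven m = ∃[ k ] m ≡ k Data.Nat.+ k

IsOdd : ℕ → Set
IsOdd m = ∃[ k ] m ≡ suc (k Data.Nat.+ k)

module Buildings {c ℓ : Level} (F : Field c ℓ) where
  open Field F

  Vect : ℕ → Set c
  Vect n = Fin n → Carrier

  _≈ᵥ_ : ∀ {n} → Vect n → Vect n → Set ℓ
  u ≈ᵥ v = ∀ k → u k ≈ v k

  0ᵥ : ∀ {n} → Vect n
  0ᵥ _ = 0#

  _+ᵥ_ : ∀ {n} → Vect n → Vect n → Vect n
  (u +ᵥ v) k = u k + v k

  _·ᵥ_ : ∀ {n} → Carrier → Vect n → Vect n
  (a ·ᵥ v) k = a * v k

  record Subspace (n : ℕ) : Set (Level.suc (c ⊔ ℓ)) where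
    field
      mem     : Vect n → Set (c ⊔ ℓ)
      resp    : ∀ {u v} → u ≈ᵥ v → mem u → mem v
      has-0   : mem 0ᵥ
      closed+ : ∀ {u v} → mem u → mem v → mem (u +ᵥ v)
      closed· : ∀ a {v} → mem v → mem (a ·ᵥ v)
  open Subspace public

  _⊆_ : ∀ {n} → Subspace n → Subspace n → Set (c ⊔ ℓ)
  U ⊆ W = ∀ v → mem U v → mem W v

  _≐_ : ∀ {n} → Subspace n → Subspace n → Set (c ⊔ ℓ)
  U ≐ W = (U ⊆ W) × (W ⊆ U)

  _⊊_ : ∀ {n} → Subspace n → Subspace n → Set (c ⊔ ℓ)
  U ⊊ W = (U ⊆ W) × ¬ (W ⊆ U)

  IsZero : ∀ {n} → Subspace n → Set (c ⊔ ℓ)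
  IsZero U = ∀ v → mem U v → v ≈ᵥ 0ᵥ

  IsFull : ∀ {n} → Subspace n → Set (c ⊔ ℓ)
  IsFull U = ∀ v → mem U v

  -- nonzero proper subspaces of F^n (the vertices x_W of B(F^n))
  NPSub : ℕ → Set (Level.suc (c ⊔ ℓ))
  NPSub n = Σ (Subspace n) λ W → ¬ IsZero W × ¬ IsFull W

  -- For subspaces A ⊆ U, U' ⊆ B:  U ∩ U' = A  and  U + U' = B.
  -- With A = 0 this says B = U ⊕ U'; with A = W, B = V it says that
  -- V/W = (U/W) ⊕ (U'/W).
  Complementary : ∀ {n} → (A B U U' : Subspace n) → Set (c ⊔ ℓ)
  Complementary A B U U' =
    (∀ v → mem U v → mem U' v → mem A v) ×
    (∀ v → mem B v → Σ (Vect _) λ u → Σ (Vect _) λ u' →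
                       mem U u × mem U' u' × (v ≈ᵥ (u +ᵥ u')))

  DirectSum : ∀ {n} → (U U' : Subspace n) → Set (c ⊔ ℓ)
  DirectSum U U' = (∀ v → mem U v → mem U' v → v ≈ᵥ 0ᵥ) ×
    (∀ v → Σ (Vect _) λ u → Σ (Vect _) λ u' →
              mem U u × mem U' u' × (v ≈ᵥ (u +ᵥ u')))

  -- The join B(V_1,...,V_r) with V_i = F^(n i)
  module Join {r : ℕ} (n : Fin r → ℕ) where

    Vertex : Set (Level.suc (c ⊔ ℓ))
    Vertex = Σ (Fin r) λ i → NPSub (n i)

    data _≈V_ : Vertex → Vertex → Set (Level.suc (c ⊔ ℓ)) where
      same : ∀ {i} {W W' : NPSub (n i)} → proj₁ W ≐ proj₁ W' →
             (i , W) ≈V (i , W')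

    data Adjacent : Vertex → Vertex → Set (Level.suc (c ⊔ ℓ)) where
      diff   : ∀ {i j} {U : NPSub (n i)} {W : NPSub (n j)} → i ≢ j →
               Adjacent (i , U) (j , W)
      sameLe : ∀ {i} {U W : NPSub (n i)} → proj₁ U ⊆ proj₁ W →
               Adjacent (i , U) (i , W)
      sameGe : ∀ {i} {U W : NPSub (n i)} → proj₁ W ⊆ proj₁ U →
               Adjacent (i , U) (i , W)

    zeroSub : ∀ {m} → Subspace m
    zeroSub = record
      { mem = λ v → Level.Lift c (v ≈ᵥ 0ᵥ)
      ; resp = λ {u} {v} e (Level.lift p) → Level.lift (λ k → trans (sym (e k)) (p k))
      ; has-0 = Level.lift (λ k → refl)
      ; closed+ = λ (Level.lift p) (Level.lift q) →
          Level.lift (λ k → trans (+-cong (p k) (q k)) (+-identityˡ 0#))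
      ; closed· = λ a (Level.lift p) →
          Level.lift (λ k → trans (*-cong refl (p k)) (zeroʳ a))
      }

    fullSub : ∀ {m} → Subspace m
    fullSub = record
      { mem = λ _ → Level.Lift (c ⊔ ℓ) Data.Unit.⊤
      ; resp = λ _ p → p
      ; has-0 = Level.lift Data.Unit.tt
      ; closed+ = λ _ _ → Level.lift Data.Unit.tt
      ; closed· = λ _ _ → Level.lift Data.Unit.tt
      }
      where import Data.Unit

    -- The link of x_W (W ⊆ V_i) is the join of the B(V_j), j ≠ i,
    -- with B(W) and B(V_i/W); opposite = same factor, opposite there.
    -- Vertices of B(V_i/W) are identified with subspaces W ⊊ U ⊊ V_i.
    data OppLink : Vertex → Vertex → Vertex → Set (Level.suc (c ⊔ ℓ)) where
      other : ∀ {i j} {W : NPSub (n i)} {U U' : NPSub (n j)} → i ≢ j →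
              DirectSum (proj₁ U) (proj₁ U') →
              OppLink (i , W) (j , U) (j , U')
      below : ∀ {i} {W U U' : NPSub (n i)} →
              proj₁ U ⊊ proj₁ W → proj₁ U' ⊊ proj₁ W →
              Complementary zeroSub (proj₁ W) (proj₁ U) (proj₁ U') →
              OppLink (i , W) (i , U) (i , U')
      above : ∀ {i} {W U U' : NPSub (n i)} →
              proj₁ W ⊊ proj₁ U → proj₁ W ⊊ proj₁ U' →
              Complementary (proj₁ W) fullSub (proj₁ U) (proj₁ U') →
              OppLink (i , W) (i , U) (i , U')

    GeodesicPath : ℕ → (ℕ → Vertex) → Set (Level.suc (c ⊔ ℓ))
    GeodesicPath m x =
      (∀ s → s < m → ¬ (x s ≈V x (suc s)) × Adjacent (x s) (x (suc s))) ×
      (∀ s → suc s < m → OppLink (x (suc s)) (x s) (x (suc (suc s))))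

    extendCycle : ℕ → (ℕ → Vertex) → ℕ → Vertex
    extendCycle l x s with s Data.Nat.≟ suc l
    ... | Relation.Nullary.yes _ = x 1
    ... | Relation.Nullary.no _  = x s

    GeodesicCycle : ℕ → (ℕ → Vertex) → Set (Level.suc (c ⊔ ℓ))
    GeodesicCycle l x = (x l ≈V x 0) × GeodesicPath (suc l) (extendCycle l x)

    data AdjX0 (i : Fin r) : Vertex → Vertex → Set (Level.suc (c ⊔ ℓ)) where
      adj : ∀ {U U' : NPSub (n i)} → DirectSum (proj₁ U) (proj₁ U') →
            AdjX0 i (i , U) (i , U')

  module Single (m : ℕ) = Join {1} (λ _ → m)

{-# OPTIONS --safe #-}
module Submission where

-- Two vertices that are opposite in the link of a third lie in the same factor, so the
-- factors of the vertices along a geodesic path have period two.  If x₀ and x₁ lie in the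
-- same factor V_i the whole cycle lives in B(V_i), and the geodesic conditions in the
-- join are exactly those in B(V_i).  Otherwise the factors alternate between V_i and V_j:
-- consecutive vertices are then automatically distinct and adjacent, and x_{s}, x_{s+2}
-- are opposite in the link of x_{s+1} precisely when V = W_s ⊕ W_{s+2}, i.e. when they
-- are adjacent in X₀.  Closing up the cycle (x_l = x₀) forces l to be even.

open import Defs
open import Level using (Level)
open import Data.Nat using (ℕ; zero; suc; _≤_; _<_; _+_; _∸_; z≤n; s≤s; s≤s⁻¹; _≟_)
open import Data.Nat.Properties
  using (+-suc; +-comm; suc-injective; ≤-refl; <⇒≤; n≤1+n; m≤n⇒m≤1+n; 1+n≰n; ≤∧≢⇒<; m≤n⇒m<n∨m≡n)
open import Data.Fin using (Fin; zero)
import Data.Fin as Fin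
open import Data.Product using (Σ; _×_; _,_; proj₁; proj₂)
import Data.Product as Product
open import Data.Sum using (_⊎_; inj₁; inj₂; [_,_]′)
open import Data.Empty using (⊥-elim)
open import Function using (_∘_; id)
open import Function.Bundles using (_⇔_; mk⇔; Equivalence)
open import Relation.Nullary using (¬_; yes; no)
open import Relation.Binary.PropositionalEquality
  using (_≡_; _≢_; refl; sym; trans; cong; subst; subst₂; module ≡-Reasoning)

even⊎odd : ∀ t → IsEven t ⊎ IsOdd t
even⊎odd zero = inj₁ (0 , refl)
even⊎odd (suc t) with even⊎odd t
... | inj₁ (k , refl) = inj₂ (k , refl)
... | inj₂ (k , refl) = inj₁ (suc k , cong suc (sym (+-suc k k)))

odd⇒even-suc : ∀ {t} → IsOdd t → IsEven (suc t)
odd⇒even-suc (k , refl) = suc k , cong suc (sym (+-suc k k))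

even-suc⇒odd : ∀ {t} → IsEven (suc t) → IsOdd t
even-suc⇒odd (suc k , eq) = k , trans (suc-injective eq) (+-suc k k)

module _ {a} {A : Set a} where
  alternate : A → A → ℕ → A
  alternate i j zero = i
  alternate i j (suc t) = alternate j i t

  alternate-even : ∀ {i j t} → IsEven t → alternate i j t ≡ i
  alternate-even (zero , refl) = refl
  alternate-even {i} {j} (suc k , refl) rewrite +-suc k k = alternate-even (k , refl)

  alternate-odd : ∀ {i j t} → IsOdd t → alternate i j t ≡ j
  alternate-odd (k , refl) = alternate-even (k , refl)

  ≡alternate⇔parity : ∀ {i j a : A} t → a ≡ alternate i j t ⇔ ((IsEven t → a ≡ i) × (IsOdd t → a ≡ j))
  ≡alternate⇔parity t = mk⇔
    (λ a≡ → (λ e → trans a≡ (alternate-even e)) , (λ o → trans a≡ (alternate-odd o)))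
    (λ (even⇒≡i , odd⇒≡j) → [ (λ e → trans (even⇒≡i e) (sym (alternate-even e))) ,
                                (λ o → trans (odd⇒≡j o) (sym (alternate-odd o))) ]′ (even⊎odd t))

  alternate-self : ∀ i t → alternate i i t ≡ i
  alternate-self i zero = refl
  alternate-self i (suc t) = alternate-self i t

  alternate-suc-≢ : ∀ {i j} → i ≢ j → ∀ t → alternate i j (suc t) ≢ alternate i j t
  alternate-suc-≢ i≢j zero = i≢j ∘ sym
  alternate-suc-≢ i≢j (suc t) = alternate-suc-≢ (i≢j ∘ sym) t

  alternate≡first⇒even : ∀ {i j : A} {t} → i ≢ j → alternate i j t ≡ i → IsEven t
  alternate≡first⇒even {t = t} i≢j alt≡i =
    [ id , (λ o → ⊥-elim (i≢j (trans (sym alt≡i) (alternate-odd o)))) ]′ (even⊎odd t)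

  period-two⇒alternate : ∀ {m} (f : ℕ → A) → (∀ s → 2 + s ≤ m → f (2 + s) ≡ f s) →
                         ∀ s → s ≤ m → f s ≡ alternate (f 0) (f 1) s
  period-two⇒alternate f period zero _ = refl
  period-two⇒alternate f period (suc zero) _ = refl
  period-two⇒alternate f period (suc (suc s)) h =
    trans (period s h) (period-two⇒alternate f period s (<⇒≤ (<⇒≤ h)))

even⇒¬odd : ∀ {t} → IsEven t → ¬ IsOdd t
even⇒¬odd e o with trans (sym (alternate-even {i = 0} {j = 1} e)) (alternate-odd o)
... | ()

even≤odd⇒< : ∀ {s t} → IsEven s → IsOdd t → s ≤ t → s < t
even≤odd⇒< e o s≤t = ≤∧≢⇒< s≤t λ { refl → even⇒¬odd e o }

odd≤odd⇒≡∨2+≤ : ∀ {s t} → IsOdd s → IsOdd t → s ≤ t → s ≡ t ⊎ 2 + s ≤ t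
odd≤odd⇒≡∨2+≤ os ot s≤t with m≤n⇒m<n∨m≡n s≤t
... | inj₁ s<t = inj₂ (even≤odd⇒< (odd⇒even-suc os) ot s<t)
... | inj₂ s≡t = inj₁ s≡t

extendCycle-map : ∀ {c ℓ} {F : Field c ℓ} {r r'} {n : Fin r → ℕ} {n' : Fin r' → ℕ} →
                  let open Buildings F in
                  (g : Join.Vertex n → Join.Vertex n') → ∀ l x s →
                  Join.extendCycle n' l (g ∘ x) s ≡ g (Join.extendCycle n l x s)
extendCycle-map g l x s with s ≟ suc l
... | yes _ = refl
... | no _  = refl

module JoinProperties {c ℓ : Level} (F : Field c ℓ) {r : ℕ} (n : Fin r → ℕ) where
  open Buildings F
  open Join n

  ≈V-refl : ∀ {a} → a ≈V a
  ≈V-refl = same ((λ _ z → z) , (λ _ z → z))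

  ≈V-reflexive : ∀ {a b} → a ≡ b → a ≈V b
  ≈V-reflexive refl = ≈V-refl

  ≈V-sym : ∀ {a b} → a ≈V b → b ≈V a
  ≈V-sym (same (p , q)) = same (q , p)

  ≈V-trans : ∀ {a b d} → a ≈V b → b ≈V d → a ≈V d
  ≈V-trans (same (p , q)) (same (p' , q')) = same ((λ v → p' v ∘ p v) , (λ v → q v ∘ q' v))

  ≈V⇒factor-≡ : ∀ {a b} → a ≈V b → proj₁ a ≡ proj₁ b
  ≈V⇒factor-≡ (same _) = refl

  ⊊-resp : ∀ {i} {U U' W W' : NPSub (n i)} → (i , U) ≈V (i , U') → (i , W) ≈V (i , W') →
           proj₁ U ⊊ proj₁ W → proj₁ U' ⊊ proj₁ W'
  ⊊-resp (same (f , g)) (same (f' , g')) (U⊆W , W⊈U) =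
    (λ v → f' v ∘ U⊆W v ∘ g v) , λ W'⊆U' → W⊈U (λ v → g v ∘ W'⊆U' v ∘ f' v)

  DirectSum-resp : ∀ {i} {U U' W W' : NPSub (n i)} → (i , U) ≈V (i , U') → (i , W) ≈V (i , W') →
                   DirectSum (proj₁ U) (proj₁ W) → DirectSum (proj₁ U') (proj₁ W')
  DirectSum-resp (same (f , g)) (same (f' , g')) (meet , span) =
    (λ v u w → meet v (g v u) (g' v w)) ,
    (λ v → let (u , w , mu , mw , v≈u+w) = span v in u , w , f u mu , f' w mw , v≈u+w)

  Complementary-resp : ∀ {i} {A A' B B' : Subspace (n i)} {U U' W W' : NPSub (n i)} →
                       A ⊆ A' → B' ⊆ B → (i , U) ≈V (i , U') → (i , W) ≈V (i , W') →
                       Complementary A B (proj₁ U) (proj₁ W) → Complementary A' B' (proj₁ U') (proj₁ W')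
  Complementary-resp A⊆A' B'⊆B (same (f , g)) (same (f' , g')) (meet , span) =
    (λ v u w → A⊆A' v (meet v (g v u) (g' v w))) ,
    (λ v b → let (u , w , mu , mw , v≈u+w) = span v (B'⊆B v b) in u , w , f u mu , f' w mw , v≈u+w)

  Adjacent-resp : ∀ {a b a' b'} → a ≈V a' → b ≈V b' → Adjacent a b → Adjacent a' b'
  Adjacent-resp (same _) (same _) (diff i≢j) = diff i≢j
  Adjacent-resp (same (_ , g)) (same (f , _)) (sameLe U⊆W) = sameLe (λ v → f v ∘ U⊆W v ∘ g v)
  Adjacent-resp (same (f , _)) (same (_ , g)) (sameGe W⊆U) = sameGe (λ v → f v ∘ W⊆U v ∘ g v)

  OppLink-resp : ∀ {a b d a' b' d'} → a ≈V a' → b ≈V b' → d ≈V d' → OppLink a b d → OppLink a' b' d'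
  OppLink-resp (same _) b≈@(same _) d≈@(same _) (other i≢j ds) = other i≢j (DirectSum-resp b≈ d≈ ds)
  OppLink-resp a≈@(same {W = W} {W'} (_ , g)) b≈@(same _) d≈@(same _) (below U⊊W U'⊊W cm) =
    below (⊊-resp b≈ a≈ U⊊W) (⊊-resp d≈ a≈ U'⊊W)
          (Complementary-resp {A = zeroSub} {zeroSub} {proj₁ W} {proj₁ W'} (λ _ z → z) g b≈ d≈ cm)
  OppLink-resp a≈@(same {W = W} {W'} (f , _)) b≈@(same _) d≈@(same _) (above W⊊U W⊊U' cm) =
    above (⊊-resp a≈ b≈ W⊊U) (⊊-resp a≈ d≈ W⊊U')
          (Complementary-resp {A = proj₁ W} {proj₁ W'} {fullSub} {fullSub} f (λ _ z → z) b≈ d≈ cm)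

  GeodesicPath-cong : ∀ {m y y'} → (∀ s → s ≤ m → y s ≈V y' s) → GeodesicPath m y → GeodesicPath m y'
  GeodesicPath-cong y≈y' (steps , turns) =
    (λ s s<m → let (y≉ , adjacent) = steps s s<m in
      (λ e → y≉ (≈V-trans (y≈y' s (<⇒≤ s<m)) (≈V-trans e (≈V-sym (y≈y' (suc s) s<m))))) ,
      Adjacent-resp (y≈y' s (<⇒≤ s<m)) (y≈y' (suc s) s<m) adjacent) ,
    (λ s ss<m → OppLink-resp (y≈y' (suc s) (<⇒≤ ss<m)) (y≈y' s (<⇒≤ (<⇒≤ ss<m))) (y≈y' (2 + s) ss<m)
                             (turns s ss<m))

  extendCycle-≤ : ∀ {l} x s → s ≤ l → extendCycle l x s ≡ x s
  extendCycle-≤ {l} x s h with s ≟ suc l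
  ... | yes refl = ⊥-elim (1+n≰n h)
  ... | no _ = refl

  extendCycle-suc : ∀ l x → extendCycle l x (suc l) ≡ x 1
  extendCycle-suc l x with suc l ≟ suc l
  ... | yes _ = refl
  ... | no l≢l = ⊥-elim (l≢l refl)

  extendCycle-cong : ∀ {l x x'} → 1 ≤ l → (∀ s → s ≤ l → x s ≈V x' s) →
                     ∀ s → s ≤ suc l → extendCycle l x s ≈V extendCycle l x' s
  extendCycle-cong {l} 1≤l x≈x' s h with s ≟ suc l
  ... | yes _ = x≈x' 1 1≤l
  ... | no s≢ = x≈x' s (s≤s⁻¹ (≤∧≢⇒< h s≢))

  GeodesicCycle-cong : ∀ {l x x'} → 1 ≤ l → (∀ s → s ≤ l → x s ≈V x' s) →
                       GeodesicCycle l x → GeodesicCycle l x'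
  GeodesicCycle-cong {l} 1≤l x≈x' (closed , path) =
    ≈V-trans (≈V-sym (x≈x' l ≤-refl)) (≈V-trans closed (x≈x' 0 z≤n)) ,
    GeodesicPath-cong (extendCycle-cong 1≤l x≈x') path

  OppLink⇒sameFactor : ∀ {a b d} → OppLink a b d → proj₁ d ≡ proj₁ b
  OppLink⇒sameFactor (other _ _) = refl
  OppLink⇒sameFactor (below _ _ _) = refl
  OppLink⇒sameFactor (above _ _ _) = refl

  OppLink⇒AdjX0 : ∀ {a b d} → OppLink a b d → proj₁ a ≢ proj₁ b → AdjX0 (proj₁ b) b d
  OppLink⇒AdjX0 (other _ ds) _ = adj ds
  OppLink⇒AdjX0 (below _ _ _) i≢i = ⊥-elim (i≢i refl)
  OppLink⇒AdjX0 (above _ _ _) i≢i = ⊥-elim (i≢i refl)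

  AdjX0⇒OppLink : ∀ {j a b d} → AdjX0 j b d → proj₁ a ≢ j → OppLink a b d
  AdjX0⇒OppLink {a = _ , _} (adj ds) i≢j = other i≢j ds

  factor-≢⇒Adjacent : ∀ {a b} → proj₁ a ≢ proj₁ b → Adjacent a b
  factor-≢⇒Adjacent {_ , _} {_ , _} = diff

  GeodesicPath-factors : ∀ {m y} → GeodesicPath m y →
                         ∀ s → s ≤ m → proj₁ (y s) ≡ alternate (proj₁ (y 0)) (proj₁ (y 1)) s
  GeodesicPath-factors {y = y} (_ , turns) =
    period-two⇒alternate (proj₁ ∘ y) (λ s h → OppLink⇒sameFactor (turns s h))

  Alternating : Fin r → Fin r → ℕ → (ℕ → Vertex) → Set _
  Alternating i j m y =
    (∀ s → s ≤ m → proj₁ (y s) ≡ alternate i j s) ×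
    (∀ s → 2 + s ≤ m → AdjX0 (alternate i j s) (y s) (y (2 + s)))

  GeodesicPath⇒Alternating : ∀ {m y} → GeodesicPath m y → proj₁ (y 0) ≢ proj₁ (y 1) →
                             Alternating (proj₁ (y 0)) (proj₁ (y 1)) m y
  GeodesicPath⇒Alternating {y = y} P@(_ , turns) y₀≢y₁ = factors , adjacent
    where
    factors = GeodesicPath-factors P
    adjacent : ∀ s → 2 + s ≤ _ → AdjX0 (alternate (proj₁ (y 0)) (proj₁ (y 1)) s) (y s) (y (2 + s))
    adjacent s h = subst (λ k → AdjX0 k (y s) (y (2 + s))) (factors s (<⇒≤ (<⇒≤ h)))
      (OppLink⇒AdjX0 (turns s h) λ e → alternate-suc-≢ y₀≢y₁ s
        (trans (sym (factors (suc s) (<⇒≤ h))) (trans e (factors s (<⇒≤ (<⇒≤ h))))))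

  Alternating⇒GeodesicPath : ∀ {i j m y} → i ≢ j → Alternating i j m y → GeodesicPath m y
  Alternating⇒GeodesicPath {i} {j} {m} {y} i≢j (factors , adjacent) =
    (λ s s<m → (factors-≢ s s<m ∘ ≈V⇒factor-≡) , factor-≢⇒Adjacent (factors-≢ s s<m)) ,
    (λ s h → AdjX0⇒OppLink (adjacent s h)
               λ e → alternate-suc-≢ i≢j s (trans (sym (factors (suc s) (<⇒≤ h))) e))
    where
    factors-≢ : ∀ s → suc s ≤ m → proj₁ (y s) ≢ proj₁ (y (suc s))
    factors-≢ s h e = alternate-suc-≢ i≢j s
      (trans (sym (factors (suc s) h)) (trans (sym e) (factors s (<⇒≤ h))))

  -- W₀ is a junk value, returned for vertices outside the factor i.
  restrict : (i : Fin r) → NPSub (n i) → Vertex → NPSub (n i)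
  restrict i W₀ (j , W) with j Fin.≟ i
  ... | yes refl = W
  ... | no _ = W₀

  ≡-restrict : ∀ {i} W₀ x → proj₁ x ≡ i → x ≡ (i , restrict i W₀ x)
  ≡-restrict W₀ (j , W) refl with j Fin.≟ j
  ... | yes refl = refl
  ... | no j≢j = ⊥-elim (j≢j refl)

  module FactorEmbedding (i : Fin r) where
    private module S = Single (n i)

    embed : S.Vertex → Vertex
    embed (_ , W) = i , W

    embed-≈V : ∀ {a b} → a S.≈V b → embed a ≈V embed b
    embed-≈V (S.same e) = same e

    embed-≈V⁻¹ : ∀ {a b} → embed a ≈V embed b → a S.≈V b
    embed-≈V⁻¹ {zero , _} {zero , _} (same e) = S.same e

    embed-Adjacent : ∀ {a b} → S.Adjacent a b → Adjacent (embed a) (embed b)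
    embed-Adjacent {zero , _} {zero , _} (S.diff 0≢0) = ⊥-elim (0≢0 refl)
    embed-Adjacent (S.sameLe U⊆W) = sameLe U⊆W
    embed-Adjacent (S.sameGe W⊆U) = sameGe W⊆U

    embed-Adjacent⁻¹ : ∀ {a b} → Adjacent (embed a) (embed b) → S.Adjacent a b
    embed-Adjacent⁻¹ {zero , _} {zero , _} (diff i≢i) = ⊥-elim (i≢i refl)
    embed-Adjacent⁻¹ {zero , _} {zero , _} (sameLe U⊆W) = S.sameLe U⊆W
    embed-Adjacent⁻¹ {zero , _} {zero , _} (sameGe W⊆U) = S.sameGe W⊆U

    embed-OppLink : ∀ {a b d} → S.OppLink a b d → OppLink (embed a) (embed b) (embed d)
    embed-OppLink {zero , _} {zero , _} (S.other 0≢0 _) = ⊥-elim (0≢0 refl)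
    embed-OppLink (S.below U⊊W U'⊊W cm) = below U⊊W U'⊊W cm
    embed-OppLink (S.above W⊊U W⊊U' cm) = above W⊊U W⊊U' cm

    embed-OppLink⁻¹ : ∀ {a b d} → OppLink (embed a) (embed b) (embed d) → S.OppLink a b d
    embed-OppLink⁻¹ {zero , _} {zero , _} {zero , _} (other i≢i _) = ⊥-elim (i≢i refl)
    embed-OppLink⁻¹ {zero , _} {zero , _} {zero , _} (below U⊊W U'⊊W cm) = S.below U⊊W U'⊊W cm
    embed-OppLink⁻¹ {zero , _} {zero , _} {zero , _} (above W⊊U W⊊U' cm) = S.above W⊊U W⊊U' cm

    GeodesicPath-embed : ∀ {m y} → S.GeodesicPath m y ⇔ GeodesicPath m (embed ∘ y)
    GeodesicPath-embed = mk⇔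
      (Product.map (λ steps s h → Product.map (_∘ embed-≈V⁻¹) embed-Adjacent (steps s h))
                   (λ turns s h → embed-OppLink (turns s h)))
      (Product.map (λ steps s h → Product.map (_∘ embed-≈V) embed-Adjacent⁻¹ (steps s h))
                   (λ turns s h → embed-OppLink⁻¹ (turns s h)))

    GeodesicCycle-embed : ∀ {l y} → S.GeodesicCycle l y ⇔ GeodesicCycle l (embed ∘ y)
    GeodesicCycle-embed {l} {y} = mk⇔
      (Product.map embed-≈V
         (GeodesicPath-cong (λ s _ → ≈V-reflexive (sym (extendCycle-map embed l y s)))
          ∘ Equivalence.to GeodesicPath-embed))
      (Product.map embed-≈V⁻¹
         (Equivalence.from GeodesicPath-embed
          ∘ GeodesicPath-cong (λ s _ → ≈V-reflexive (extendCycle-map embed l y s))))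

module Cycles {c ℓ : Level} (F : Field c ℓ) {r : ℕ} (n : Fin r → ℕ) where
  open Buildings F
  open Join n
  open JoinProperties F n
  open ≡-Reasoning

  SingleFactorCycle : ℕ → (ℕ → Vertex) → Set _
  SingleFactorCycle l x =
    Σ (Fin r) λ i → Σ (ℕ → NPSub (n i)) λ W →
      (∀ s → s ≤ l → x s ≈V (i , W s)) ×
      Single.GeodesicCycle (n i) l (λ s → (zero , W s))

  TwoFactorCycle : ℕ → (ℕ → Vertex) → Set _
  TwoFactorCycle l x =
    Σ (Fin r) λ i → Σ (Fin r) λ j →
      i ≢ j × proj₁ (x 0) ≡ i ×
      (∀ s → s ≤ l → (IsEven s → proj₁ (x s) ≡ i) × (IsOdd s → proj₁ (x s) ≡ j)) ×
      IsEven l ×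
      ((∀ s → s + 2 ≤ l → IsEven s → AdjX0 i (x s) (x (s + 2))) × (x l ≈V x 0)) ×
      ((∀ s → s + 2 ≤ l ∸ 1 → IsOdd s → AdjX0 j (x s) (x (s + 2))) × AdjX0 j (x (l ∸ 1)) (x 1))

  -- For l = suc k, extendCycle l x 0 and extendCycle l x 1 compute to x 0 and x 1; the
  -- next two lemmas rely on this when reading off the factors of x 0 and x 1.
  GeodesicCycle⇒SingleFactor : ∀ {k x} → GeodesicCycle (suc k) x → proj₁ (x 0) ≡ proj₁ (x 1) →
                               SingleFactorCycle (suc k) x
  GeodesicCycle⇒SingleFactor {k} {x} C@(_ , path) x₀∼x₁ =
    i , W , x≈W , Equivalence.from (FactorEmbedding.GeodesicCycle-embed i) (GeodesicCycle-cong (s≤s z≤n) x≈W C)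
    where
    i = proj₁ (x 0)
    W = λ s → restrict i (proj₂ (x 0)) (x s)
    inFactor : ∀ s → s ≤ suc k → proj₁ (x s) ≡ i
    inFactor s h = begin
      proj₁ (x s)                       ≡⟨ cong proj₁ (extendCycle-≤ x s h) ⟨
      proj₁ (extendCycle (suc k) x s)   ≡⟨ GeodesicPath-factors path s (m≤n⇒m≤1+n h) ⟩
      alternate i (proj₁ (x 1)) s       ≡⟨ cong (λ j → alternate i j s) x₀∼x₁ ⟨
      alternate i i s                   ≡⟨ alternate-self i s ⟩
      i                                 ∎
    x≈W : ∀ s → s ≤ suc k → x s ≈V (i , W s)
    x≈W s h = ≈V-reflexive (≡-restrict (proj₂ (x 0)) (x s) (inFactor s h))

  GeodesicCycle⇒TwoFactor : ∀ {k x} → GeodesicCycle (suc k) x → proj₁ (x 0) ≢ proj₁ (x 1) →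
                            TwoFactorCycle (suc k) x
  GeodesicCycle⇒TwoFactor {k} {x} (closed , path) i≢j =
    i , j , i≢j , refl ,
    (λ s h → Equivalence.to (≡alternate⇔parity s) (xFactors s h)) ,
    l-even ,
    ((λ s h e → adjacentAt s (subst (_≤ suc k) (+-comm s 2) h) (alternate-even e)) , closed) ,
    ((λ s h o → adjacentAt s (m≤n⇒m≤1+n (subst (_≤ k) (+-comm s 2) h)) (alternate-odd o)) , wrap)
    where
    i = proj₁ (x 0)
    j = proj₁ (x 1)
    y = extendCycle (suc k) x
    alternating = GeodesicPath⇒Alternating path i≢j
    xFactors : ∀ s → s ≤ suc k → proj₁ (x s) ≡ alternate i j s
    xFactors s h = trans (cong proj₁ (sym (extendCycle-≤ x s h))) (proj₁ alternating s (m≤n⇒m≤1+n h))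
    l-even : IsEven (suc k)
    l-even = alternate≡first⇒even i≢j (trans (sym (xFactors (suc k) ≤-refl)) (≈V⇒factor-≡ closed))
    adjacentAt : ∀ {q} s → 2 + s ≤ suc k → alternate i j s ≡ q → AdjX0 q (x s) (x (s + 2))
    adjacentAt s h refl rewrite +-comm s 2 =
      subst₂ (AdjX0 _) (extendCycle-≤ x s (<⇒≤ (<⇒≤ h))) (extendCycle-≤ x (2 + s) h)
             (proj₂ alternating s (m≤n⇒m≤1+n h))
    wrap : AdjX0 j (x k) (x 1)
    wrap = subst₂ (λ q a → AdjX0 q a (x 1)) (alternate-odd (even-suc⇒odd l-even))
                  (extendCycle-≤ x k (n≤1+n k))
             (subst (AdjX0 _ (y k)) (extendCycle-suc (suc k) x) (proj₂ alternating k ≤-refl))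

  TwoFactor⇒GeodesicCycle : ∀ {k x} → TwoFactorCycle (suc k) x → GeodesicCycle (suc k) x
  TwoFactor⇒GeodesicCycle {k} {x} (i , j , i≢j , _ , parity , l-even , (adjEven , closed) , (adjOdd , wrap)) =
    closed , Alternating⇒GeodesicPath i≢j (yFactors , yAdjacent)
    where
    y = extendCycle (suc k) x
    k-odd = even-suc⇒odd l-even
    xFactors : ∀ s → s ≤ suc k → proj₁ (x s) ≡ alternate i j s
    xFactors s h = Equivalence.from (≡alternate⇔parity s) (parity s h)
    yFactors : ∀ s → s ≤ 2 + k → proj₁ (y s) ≡ alternate i j s
    yFactors s h with m≤n⇒m<n∨m≡n h
    ... | inj₁ s<2+k = trans (cong proj₁ (extendCycle-≤ x s (s≤s⁻¹ s<2+k))) (xFactors s (s≤s⁻¹ s<2+k))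
    ... | inj₂ refl = trans (cong proj₁ (extendCycle-suc (suc k) x))
                            (trans (xFactors 1 (s≤s z≤n)) (sym (alternate-even l-even)))
    x⇒yAdjacent : ∀ {q} s → 2 + s ≤ suc k → q ≡ alternate i j s → AdjX0 q (x s) (x (s + 2)) →
            AdjX0 (alternate i j s) (y s) (y (2 + s))
    x⇒yAdjacent s h refl a rewrite +-comm s 2 =
      subst₂ (AdjX0 _) (sym (extendCycle-≤ x s (<⇒≤ (<⇒≤ h)))) (sym (extendCycle-≤ x (2 + s) h)) a
    yAdjacent : ∀ s → 2 + s ≤ 2 + k → AdjX0 (alternate i j s) (y s) (y (2 + s))
    yAdjacent s (s≤s (s≤s s≤k)) with even⊎odd s
    ... | inj₁ e = let 2+s≤l = s≤s (even≤odd⇒< e k-odd s≤k) in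
                   x⇒yAdjacent s 2+s≤l (sym (alternate-even e)) (adjEven s (subst (_≤ suc k) (+-comm 2 s) 2+s≤l) e)
    ... | inj₂ o with odd≤odd⇒≡∨2+≤ o k-odd s≤k
    ...   | inj₂ 2+s≤k = x⇒yAdjacent s (m≤n⇒m≤1+n 2+s≤k) (sym (alternate-odd o))
                           (adjOdd s (subst (_≤ k) (+-comm 2 s) 2+s≤k) o)
    ...   | inj₁ refl =
      subst₂ (λ q a → AdjX0 q a (y (2 + s))) (sym (alternate-odd o)) (sym (extendCycle-≤ x s (n≤1+n s)))
             (subst (AdjX0 j (x s)) (sym (extendCycle-suc (suc s) x)) wrap)

  SingleFactor⇒GeodesicCycle : ∀ {k x} → SingleFactorCycle (suc k) x → GeodesicCycle (suc k) x
  SingleFactor⇒GeodesicCycle (i , W , x≈W , C) =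
    GeodesicCycle-cong (s≤s z≤n) (λ s h → ≈V-sym (x≈W s h))
                       (Equivalence.to (FactorEmbedding.GeodesicCycle-embed i) C)

  GeodesicCycle⇔Single⊎TwoFactor : ∀ k x →
    GeodesicCycle (suc k) x ⇔ (SingleFactorCycle (suc k) x ⊎ TwoFactorCycle (suc k) x)
  GeodesicCycle⇔Single⊎TwoFactor k x =
    mk⇔ split [ SingleFactor⇒GeodesicCycle , TwoFactor⇒GeodesicCycle ]′
    where
    split : GeodesicCycle (suc k) x → SingleFactorCycle (suc k) x ⊎ TwoFactorCycle (suc k) x
    split C with proj₁ (x 0) Fin.≟ proj₁ (x 1)
    ... | yes x₀∼x₁ = inj₁ (GeodesicCycle⇒SingleFactor C x₀∼x₁)
    ... | no x₀≁x₁  = inj₂ (GeodesicCycle⇒TwoFactor C x₀≁x₁)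

proposition1p3p9 : ∀ {c ℓ : Level} (F : Field c ℓ) (r : ℕ) (n : Fin r → ℕ) →
    let open Buildings F in
    let open Join n in
    (l : ℕ) → 1 ≤ l → (x : ℕ → Vertex) →
    GeodesicCycle l x ⇔
      ( ( Σ (Fin r) λ i → Σ (ℕ → NPSub (n i)) λ W →
            (∀ s → s ≤ l → x s ≈V (i , W s)) ×
            Single.GeodesicCycle (n i) l (λ s → (zero , W s)) )
      ⊎ ( Σ (Fin r) λ i → Σ (Fin r) λ j →
            i ≢ j × proj₁ (x 0) ≡ i ×
            (∀ s → s ≤ l → (IsEven s → proj₁ (x s) ≡ i) × (IsOdd s → proj₁ (x s) ≡ j)) ×
            IsEven l ×
            ((∀ s → s + 2 ≤ l → IsEven s → AdjX0 i (x s) (x (s + 2))) × (x l ≈V x 0)) ×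
            ((∀ s → s + 2 ≤ l ∸ 1 → IsOdd s → AdjX0 j (x s) (x (s + 2))) × AdjX0 j (x (l ∸ 1)) (x 1)) ) )
proposition1p3p9 F r n (suc k) _ x = Cycles.GeodesicCycle⇔Single⊎TwoFactor F n k x
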